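{- Let $G$ be a minimal counterexample as described in the context. Then the minimum degree of $G$ satisfies $\delta(G) \geq 3$.
   Context: All graphs are finite and simple. A 2-distance $k$-coloring of a graph $G$ is a map $\phi: V(G)\to\{1,\dots,k\}$ with $\phi(x)\neq\phi(y)$ whenever $x\neq y$ are at distance at most two; $\chi_2(G)$ is the least such $k$. A minimal counterexample is a planar graph $G$ with maximum degree $\Delta(G)\leq 6$ and $\chi_2(G)>20$ such that every planar graph $H$ with $\Delta(H)\leq 6$ and $|V(H)|+|E(H)|<|V(G)|+|E(G)|$ satisfies $\chi_2(H)\leq 20$. -}

module Defs where

open import Data.Nat as Nat using (ℕ; zero; suc; _≤_; _<_; _+_)
open import Data.Nat.ListAction using (sum)
open import Data.Bool using (Bool; true; false; if_then_else_; _∧_)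
open import Data.Fin using (Fin; toℕ)
open import Data.List using (List; []; _∷_; _++_; map; allFin; length; lookup)
open import Data.Product using (Σ; ∃; ∃-syntax; _×_; _,_; proj₁; proj₂)
open import Data.Sum using (_⊎_)
open import Relation.Nullary using (¬_)
open import Relation.Binary.PropositionalEquality using (_≡_; _≢_)
open import Data.Rational as ℚ using (ℚ; 0ℚ; 1ℚ)

record Graph : Set where
  field
    n      : ℕ
    adj    : Fin n → Fin n → Bool
    sym    : ∀ i j → adj i j ≡ adj j i
    irrefl : ∀ i → adj i i ≡ false

open Graph public

Adj : (G : Graph) → Fin (n G) → Fin (n G) → Set
Adj G i j = adj G i j ≡ true

b2n : Bool → ℕ
b2n true  = 1
b2n false = 0

degree : (G : Graph) → Fin (n G) → ℕ
degree G v = sum (map (λ j → b2n (adj G v j)) (allFin (n G)))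

numEdges : (G : Graph) → ℕ
numEdges G = sum (map (λ i → sum (map (λ j → b2n (adj G i j ∧ (toℕ i Nat.<ᵇ toℕ j)))
                                     (allFin (n G))))
                      (allFin (n G)))

size : Graph → ℕ
size G = n G + numEdges G

MaxDegreeAtMost : ℕ → Graph → Set
MaxDegreeAtMost d G = ∀ v → degree G v ≤ d

MinDegreeAtLeast : ℕ → Graph → Set
MinDegreeAtLeast d G = ∀ v → d ≤ degree G v

Within2 : (G : Graph) → Fin (n G) → Fin (n G) → Set
Within2 G x y = x ≢ y × (Adj G x y ⊎ ∃[ z ] (Adj G x z × Adj G z y))

TwoDistColoring : (G : Graph) (k : ℕ) → (Fin (n G) → Fin k) → Set
TwoDistColoring G k φ = ∀ x y → Within2 G x y → φ x ≢ φ y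

TwoDistColorable : ℕ → Graph → Set
TwoDistColorable k G = Σ (Fin (n G) → Fin k) (TwoDistColoring G k)

-- Planarity: existence of a plane drawing with polygonal arcs
-- (Diestel, Graph Theory, Ch. 4), with bend points in ℚ².

Point : Set
Point = ℚ × ℚ

OnSeg : Point → Point × Point → Set
OnSeg (px , py) ((ax , ay) , (bx , by)) =
  Σ ℚ λ t → (0ℚ ℚ.≤ t) × (t ℚ.≤ 1ℚ) ×
    (px ≡ ax ℚ.+ t ℚ.* (bx ℚ.- ax)) × (py ≡ ay ℚ.+ t ℚ.* (by ℚ.- ay))

segs : List Point → List (Point × Point)
segs []             = []
segs (a ∷ [])       = []
segs (a ∷ b ∷ rest) = (a , b) ∷ segs (b ∷ rest)

OnPoly : Point → List Point → Set
OnPoly p ps = Σ (Fin (length (segs ps))) λ k → OnSeg p (lookup (segs ps) k)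

-- the polygonal curve is an arc (no self-intersections): non-consecutive
-- segments are disjoint, consecutive ones meet only in their shared point
IsPolyArc : List Point → Set
IsPolyArc ps = ∀ (k l : Fin (length (segs ps))) → toℕ k < toℕ l → ∀ p →
  OnSeg p (lookup (segs ps) k) → OnSeg p (lookup (segs ps) l) →
  (toℕ l ≡ suc (toℕ k)) × (p ≡ proj₂ (lookup (segs ps) k))

Edge : Graph → Set
Edge G = Σ (Fin (n G) × Fin (n G)) λ e → Adj G (proj₁ e) (proj₂ e) × (toℕ (proj₁ e) < toℕ (proj₂ e))

record PlaneDrawing (G : Graph) : Set where
  field
    pos       : Fin (n G) → Point
    pos-inj   : ∀ u v → pos u ≡ pos v → u ≡ v
    bends     : Edge G → List Point
  arc : Edge G → List Point
  arc e = pos (proj₁ (proj₁ e)) ∷ (bends e ++ (pos (proj₂ (proj₁ e)) ∷ []))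
  field
    arc-simple  : ∀ e → IsPolyArc (arc e)
    arc-avoids  : ∀ e w → OnPoly (pos w) (arc e) →
                  (w ≡ proj₁ (proj₁ e)) ⊎ (w ≡ proj₂ (proj₁ e))
    arcs-disj   : ∀ e f → proj₁ e ≢ proj₁ f → ∀ p →
                  OnPoly p (arc e) → OnPoly p (arc f) → ∃[ v ] (p ≡ pos v)

Planar : Graph → Set
Planar G = PlaneDrawing G

record MinimalCounterexample (G : Graph) : Set₁ where
  field
    planar    : Planar G
    maxDeg    : MaxDegreeAtMost 6 G
    notColor  : ¬ TwoDistColorable 20 G
    minimal   : ∀ (H : Graph) → Planar H → MaxDegreeAtMost 6 H →
                size H < size G → TwoDistColorable 20 H

{-# OPTIONS --safe #-}
-- Suppose a vertex v has degree at most 2. Delete it and join its (at most two)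
-- neighbours by an edge drawn along the two edges through v. The resulting graph
-- H is planar, its degrees are at most those in G, and by the handshake lemma it
-- has no more edges, so it is smaller and has a 2-distance 20-colouring. That
-- colouring respects distance two in G − v, because the neighbours of v are
-- adjacent in H, and v sees at most 2 · (1 + 6) = 14 colours, leaving one for v.
module Submission where

open import Defs
open import Data.Bool using (Bool; true; false; _∧_; _∨_; not; T; T?)
open import Data.Bool.Properties using (∧-zeroʳ; ∧-identityʳ; ∧-comm; ∨-zeroʳ)
open import Data.Empty using (⊥-elim)
open import Data.Fin as Fin using (Fin; toℕ; fromℕ<; punchIn; punchOut; _≟_)
open import Data.Fin.Properties
  using (toℕ-injective; toℕ-fromℕ<; toℕ<n; punchIn-punchOut; punchOut-punchIn; punchOut-cong;
         punchInᵢ≢i; punchIn-injective; punchIn-mono-≤; pigeonhole; ¬∀⟶∃¬)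
open import Data.List
  using (List; []; _∷_; _++_; length; lookup; applyUpTo; map; allFin; tabulate; filterᵇ; concatMap)
open import Data.List.Properties using (length-applyUpTo; map-tabulate; length-++; length-map)
open import Data.List.Membership.Propositional using (_∈_; _∉_)
open import Data.List.Membership.Propositional.Properties using (∈-filter⁺; ∈-allFin; ∈-concat⁺′; ∈-map⁺)
open import Data.List.Relation.Unary.Any using (here; there; index; any?)
open import Data.List.Relation.Unary.Any.Properties using (lookup-index)
open import Data.Nat as ℕ using (ℕ; zero; suc; _≤_; _<_; _+_; _*_; _∸_; z≤n; s≤s)
open import Data.Nat.ListAction as ListAction using ()
import Data.Nat.Properties as ℕ
open import Algebra.Properties.CommutativeMonoid.Sum ℕ.+-0-commutativeMonoid
  using (sum; sum-remove; sum-cong-≗; sum-replicate-zero; ∑-distrib-+; ∑-comm)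
open import Data.Product using (Σ-syntax; ∃-syntax; _×_; _,_; proj₁; proj₂; map₂)
open import Data.Product.Properties using (≡-dec; ,-injective)
open import Data.Rational as ℚ using (0ℚ; 1ℚ)
import Data.Rational.Properties as ℚ
open import Data.Rational.Solver using (module +-*-Solver)
import Data.Sum
open import Data.Sum using (_⊎_; inj₁; inj₂)
open import Data.Unit using (tt)
open import Function using (_∘_; id)
open import Relation.Binary.Definitions using (tri<; tri≈; tri>)
open import Relation.Binary.PropositionalEquality as ≡
  using (_≡_; _≢_; refl; trans; cong; cong₂; subst; subst₂; module ≡-Reasoning)
open import Relation.Nullary using (¬_; Dec; yes; no; does)
open import Relation.Nullary.Decidable using (toWitness; from-yes; dec-true; dec-false)

-- Segments and polygonal arcs

OnSeg-start : ∀ a b → OnSeg a (a , b)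
OnSeg-start (ax , ay) (bx , by) = 0ℚ , ℚ.≤-refl , 0≤1 , at0 ax bx , at0 ay by
  where
  open +-*-Solver
  0≤1 : 0ℚ ℚ.≤ 1ℚ
  0≤1 = toWitness {a? = 0ℚ ℚ.≤? 1ℚ} _
  at0 : ∀ a b → a ≡ a ℚ.+ 0ℚ ℚ.* (b ℚ.- a)
  at0 = solve 2 (λ a b → a := a :+ con 0ℚ :* (b :- a)) refl

OnSeg-swap : ∀ {p} a b → OnSeg p (a , b) → OnSeg p (b , a)
OnSeg-swap (ax , ay) (bx , by) (t , 0≤t , t≤1 , px≡ , py≡) =
  1ℚ ℚ.- t , 0≤1-t , 1-t≤1 , trans px≡ (reparam ax bx t) , trans py≡ (reparam ay by t)
  where
  open +-*-Solver
  reparam : ∀ a b t → a ℚ.+ t ℚ.* (b ℚ.- a) ≡ b ℚ.+ (1ℚ ℚ.- t) ℚ.* (a ℚ.- b)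
  reparam = solve 3 (λ a b t → a :+ t :* (b :- a) := b :+ (con 1ℚ :- t) :* (a :- b)) refl
  0≤1-t : 0ℚ ℚ.≤ 1ℚ ℚ.- t
  0≤1-t = ℚ.+-monoʳ-≤ 1ℚ (ℚ.neg-antimono-≤ t≤1)
  1-t≤1 : 1ℚ ℚ.- t ℚ.≤ 1ℚ
  1-t≤1 = subst (1ℚ ℚ.- t ℚ.≤_) (ℚ.+-identityʳ 1ℚ) (ℚ.+-monoʳ-≤ 1ℚ (ℚ.neg-antimono-≤ 0≤t))

OnSeg-end : ∀ a b → OnSeg b (a , b)
OnSeg-end a b = OnSeg-swap b a (OnSeg-start b a)

_≟ₚ_ : (p q : Point) → Dec (p ≡ q)
_≟ₚ_ = ≡-dec ℚ._≟_ ℚ._≟_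

-- A polygonal curve with L segments is given by the points f 0, …, f L of a Path.
Path : Set
Path = ℕ → Point

segment : Path → ℕ → Point × Point
segment f k = f k , f (suc k)

IsArc : Path → ℕ → Set
IsArc f L = ∀ {p} k l → k < l → l < L → OnSeg p (segment f k) → OnSeg p (segment f l) →
            l ≡ suc k × p ≡ f (suc k)

OnPath : Path → ℕ → Point → Set
OnPath f L p = ∃[ k ] k < L × OnSeg p (segment f k)

IsArc-prefix : ∀ {f L L′} → L′ ≤ L → IsArc f L → IsArc f L′
IsArc-prefix L′≤L arc k l k<l l<L′ = arc k l k<l (ℕ.<-≤-trans l<L′ L′≤L)

OnPath-prefix : ∀ {f L L′ p} → L′ ≤ L → OnPath f L′ p → OnPath f L p
OnPath-prefix L′≤L (k , k<L′ , on) = k , ℕ.<-≤-trans k<L′ L′≤L , on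

module _ {f g : Path} {L : ℕ} (f≗g : ∀ k → k ≤ L → f k ≡ g k) where

  segment-cong : ∀ k → k < L → segment f k ≡ segment g k
  segment-cong k k<L = cong₂ _,_ (f≗g k (ℕ.<⇒≤ k<L)) (f≗g (suc k) k<L)

  IsArc-cong : IsArc f L → IsArc g L
  IsArc-cong arc {p} k l k<l l<L onₖ onₗ =
    proj₁ r , trans (proj₂ r) (f≗g (suc k) (ℕ.<-≤-trans k<l (ℕ.<⇒≤ l<L)))
    where
    move : ∀ j → j < L → OnSeg p (segment g j) → OnSeg p (segment f j)
    move j j<L = subst (OnSeg p) (≡.sym (segment-cong j j<L))
    r = arc k l k<l l<L (move k (ℕ.<-trans k<l l<L) onₖ) (move l l<L onₗ)

  OnPath-cong : ∀ {p} → OnPath f L p → OnPath g L p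
  OnPath-cong {p} (k , k<L , on) = k , k<L , subst (OnSeg p) (segment-cong k k<L) on

reversePath : Path → ℕ → Path
reversePath f L k = f (L ∸ k)

segment-reverse : ∀ {p} f L k → k < L →
                  OnSeg p (segment (reversePath f L) k) → OnSeg p (segment f (L ∸ suc k))
segment-reverse {p} f L k k<L on =
  OnSeg-swap (f (suc (L ∸ suc k))) (f (L ∸ suc k))
             (subst (λ i → OnSeg p (f i , f (L ∸ suc k))) (ℕ.+-∸-assoc 1 k<L) on)

∸-suc-< : ∀ {L k} → k < L → L ∸ suc k < L
∸-suc-< {suc L} {k} _ = s≤s (ℕ.m∸n≤m L k)

IsArc-reverse : ∀ {f L} → IsArc f L → IsArc (reversePath f L) L
IsArc-reverse {f} {L} arc k l k<l l<L onₖ onₗ = l≡1+k , trans (proj₂ r) (cong f (≡.sym (proj₁ r)))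
  where
  k<L = ℕ.<-trans k<l l<L
  r = arc (L ∸ suc l) (L ∸ suc k) (ℕ.∸-monoʳ-< (s≤s k<l) l<L) (∸-suc-< k<L)
          (segment-reverse f L l l<L onₗ) (segment-reverse f L k k<L onₖ)
  l≡1+k : l ≡ suc k
  l≡1+k = ≡.sym (ℕ.∸-cancelˡ-≡ k<L (ℕ.<⇒≤ l<L) (trans (proj₁ r) (≡.sym (ℕ.+-∸-assoc 1 l<L))))

OnPath-reverse : ∀ {f L p} → OnPath (reversePath f L) L p → OnPath f L p
OnPath-reverse {f} {L} (k , k<L , on) = L ∸ suc k , ∸-suc-< k<L , segment-reverse f L k k<L on

concatPath : Path → ℕ → Path → Path
concatPath f L g k with k ℕ.≤? L
... | yes _ = f k
... | no _  = g (k ∸ L)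

module _ {f g : Path} {L : ℕ} where

  concatPath-≤ : ∀ {k} → k ≤ L → concatPath f L g k ≡ f k
  concatPath-≤ {k} k≤L with k ℕ.≤? L
  ... | yes _  = refl
  ... | no k≰L = ⊥-elim (k≰L k≤L)

  concatPath-≥ : ∀ {k} → f L ≡ g 0 → L ≤ k → concatPath f L g k ≡ g (k ∸ L)
  concatPath-≥ {k} joint L≤k with k ℕ.≤? L
  ... | no _    = refl
  ... | yes k≤L with refl ← ℕ.≤-antisym k≤L L≤k = trans joint (cong g (≡.sym (ℕ.n∸n≡0 L)))

  segment-concat-< : ∀ {k} → k < L → segment (concatPath f L g) k ≡ segment f k
  segment-concat-< k<L = cong₂ _,_ (concatPath-≤ (ℕ.<⇒≤ k<L)) (concatPath-≤ k<L)

  segment-concat-≥ : ∀ {k} → f L ≡ g 0 → L ≤ k → segment (concatPath f L g) k ≡ segment g (k ∸ L)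
  segment-concat-≥ joint L≤k =
    cong₂ _,_ (concatPath-≥ joint L≤k)
              (trans (concatPath-≥ joint (ℕ.m≤n⇒m≤1+n L≤k)) (cong g (ℕ.+-∸-assoc 1 L≤k)))

  OnPath-concat : ∀ {L′ p} → f L ≡ g 0 → OnPath (concatPath f L g) (L + L′) p →
                  OnPath f L p ⊎ OnPath g L′ p
  OnPath-concat {L′} {p} joint (k , k<L+L′ , on) with ℕ.<-≤-connex k L
  ... | inj₁ k<L = inj₁ (k , k<L , subst (OnSeg p) (segment-concat-< k<L) on)
  ... | inj₂ L≤k = inj₂ (k ∸ L , k∸L<L′ , subst (OnSeg p) (segment-concat-≥ joint L≤k) on)
    where
    k∸L<L′ = ℕ.+-cancelˡ-< L _ _ (subst (_< L + L′) (≡.sym (ℕ.m+[n∸m]≡n L≤k)) k<L+L′)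

final-segment : ∀ {f L k} → IsArc f (suc L) → f L ≢ f (suc L) → k ≤ L →
                OnSeg (f (suc L)) (segment f k) → k ≡ L
final-segment {f} {L} {k} arc nondeg k≤L on with ℕ.m≤n⇒m<n∨m≡n k≤L
... | inj₂ k≡L = k≡L
... | inj₁ k<L = ⊥-elim (nondeg (trans (cong f (proj₁ r)) (≡.sym (proj₂ r))))
  where r = arc k L k<L (ℕ.n<1+n L) on (OnSeg-end (f L) (f (suc L)))

initial-segment : ∀ {g L l} → IsArc g L → g 1 ≢ g 0 → l < L → OnSeg (g 0) (segment g l) → l ≡ 0
initial-segment {l = zero}  arc nondeg l<L on = refl
initial-segment {g} {l = suc l} arc nondeg l<L on =
  ⊥-elim (nondeg (≡.sym (proj₂ (arc 0 (suc l) (s≤s z≤n) l<L (OnSeg-start (g 0) (g 1)) on))))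

module _ {f g : Path} {L L′ : ℕ} (arcf : IsArc f (suc L)) (arcg : IsArc g L′)
         (joint : f (suc L) ≡ g 0) (f-nondeg : f L ≢ g 0) (g-nondeg : g 1 ≢ g 0)
         (common : ∀ {q} → OnPath f (suc L) q → OnPath g L′ q → q ≡ g 0) where

  private
    h = concatPath f (suc L) g

    arc-mixed : ∀ {p k l} → k < suc L → suc L ≤ l → l < suc L + L′ →
                OnSeg p (segment h k) → OnSeg p (segment h l) → l ≡ suc k × p ≡ h (suc k)
    arc-mixed {p} {k} {l} k<1+L 1+L≤l l<end onₖ onₗ = l≡1+k , p≡
      where
      onf = subst (OnSeg p) (segment-concat-< k<1+L) onₖ
      ong = subst (OnSeg p) (segment-concat-≥ joint 1+L≤l) onₗ
      l∸1+L<L′ = ℕ.+-cancelˡ-< (suc L) _ _ (subst (_< suc L + L′) (≡.sym (ℕ.m+[n∸m]≡n 1+L≤l)) l<end)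
      p≡g0 : p ≡ g 0
      p≡g0 = common (k , k<1+L , onf) (l ∸ suc L , l∸1+L<L′ , ong)
      k≡L : k ≡ L
      k≡L = final-segment {f} arcf (λ e → f-nondeg (trans e joint))
              (ℕ.≤-pred k<1+L) (subst (λ q → OnSeg q (segment f k)) (trans p≡g0 (≡.sym joint)) onf)
      l≡1+k : l ≡ suc k
      l≡1+k = trans (ℕ.≤-antisym (ℕ.m∸n≡0⇒m≤n (initial-segment {g} arcg g-nondeg l∸1+L<L′
                       (subst (λ q → OnSeg q (segment g (l ∸ suc L))) p≡g0 ong))) 1+L≤l)
                    (cong suc (≡.sym k≡L))
      p≡ : p ≡ h (suc k)
      p≡ = trans p≡g0 (trans (≡.sym joint)
                 (trans (cong (f ∘ suc) (≡.sym k≡L)) (≡.sym (concatPath-≤ k<1+L))))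

    arc-right : ∀ {p k l} → suc L ≤ k → k < l → l < suc L + L′ →
                OnSeg p (segment h k) → OnSeg p (segment h l) → l ≡ suc k × p ≡ h (suc k)
    arc-right {p} {k} {l} 1+L≤k k<l l<end onₖ onₗ = l≡1+k , p≡
      where
      1+L≤l = ℕ.≤-trans 1+L≤k (ℕ.<⇒≤ k<l)
      r = arcg (k ∸ suc L) (l ∸ suc L) (ℕ.∸-monoˡ-< k<l 1+L≤k)
               (ℕ.+-cancelˡ-< (suc L) _ _ (subst (_< suc L + L′) (≡.sym (ℕ.m+[n∸m]≡n 1+L≤l)) l<end))
               (subst (OnSeg p) (segment-concat-≥ joint 1+L≤k) onₖ)
               (subst (OnSeg p) (segment-concat-≥ joint 1+L≤l) onₗ)
      l≡1+k : l ≡ suc k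
      l≡1+k = ℕ.∸-cancelʳ-≡ 1+L≤l (ℕ.m≤n⇒m≤1+n 1+L≤k)
                             (trans (proj₁ r) (≡.sym (ℕ.+-∸-assoc 1 1+L≤k)))
      p≡ : p ≡ h (suc k)
      p≡ = trans (proj₂ r) (trans (cong g (≡.sym (ℕ.+-∸-assoc 1 1+L≤k)))
                                  (≡.sym (concatPath-≥ joint (ℕ.m≤n⇒m≤1+n 1+L≤k))))

  IsArc-concat : IsArc (concatPath f (suc L) g) (suc L + L′)
  IsArc-concat {p} k l k<l l<end onₖ onₗ with ℕ.<-≤-connex k (suc L) | ℕ.<-≤-connex l (suc L)
  ... | inj₁ k<1+L | inj₁ l<1+L =
    proj₁ r , trans (proj₂ r) (≡.sym (concatPath-≤ k<1+L))
    where r = arcf k l k<l l<1+L (subst (OnSeg p) (segment-concat-< k<1+L) onₖ)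
                                 (subst (OnSeg p) (segment-concat-< l<1+L) onₗ)
  ... | inj₁ k<1+L | inj₂ 1+L≤l = arc-mixed k<1+L 1+L≤l l<end onₖ onₗ
  ... | inj₂ 1+L≤k | inj₁ l<1+L = ⊥-elim (ℕ.<-irrefl refl (ℕ.<-≤-trans (ℕ.<-trans k<l l<1+L) 1+L≤k))
  ... | inj₂ 1+L≤k | inj₂ _     = arc-right 1+L≤k k<l l<end onₖ onₗ

-- indices past the end of the list give a junk point
path : List Point → Path
path []       _       = 0ℚ , 0ℚ
path (x ∷ _)  zero    = x
path (_ ∷ xs) (suc k) = path xs k

lookup-segs : ∀ ps (i : Fin (length (segs ps))) → lookup (segs ps) i ≡ segment (path ps) (toℕ i)
lookup-segs (a ∷ b ∷ ps) Fin.zero    = refl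
lookup-segs (a ∷ b ∷ ps) (Fin.suc i) = lookup-segs (b ∷ ps) i

module _ (ps : List Point) where

  private
    lookup-segs-fromℕ< : ∀ {k} (k< : k < length (segs ps)) →
                         lookup (segs ps) (fromℕ< k<) ≡ segment (path ps) k
    lookup-segs-fromℕ< k< = trans (lookup-segs ps (fromℕ< k<)) (cong (segment (path ps)) (toℕ-fromℕ< k<))

  IsPolyArc⇒IsArc : IsPolyArc ps → IsArc (path ps) (length (segs ps))
  IsPolyArc⇒IsArc arc {p} k l k<l l<L onₖ onₗ =
    trans (≡.sym (toℕ-fromℕ< l<L)) (trans (proj₁ r) (cong suc (toℕ-fromℕ< k<L))) ,
    trans (proj₂ r) (cong proj₂ (lookup-segs-fromℕ< k<L))
    where
    k<L = ℕ.<-trans k<l l<L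
    r = arc (fromℕ< k<L) (fromℕ< l<L) (subst₂ _<_ (≡.sym (toℕ-fromℕ< k<L)) (≡.sym (toℕ-fromℕ< l<L)) k<l) p
            (subst (OnSeg p) (≡.sym (lookup-segs-fromℕ< k<L)) onₖ)
            (subst (OnSeg p) (≡.sym (lookup-segs-fromℕ< l<L)) onₗ)

  IsArc⇒IsPolyArc : IsArc (path ps) (length (segs ps)) → IsPolyArc ps
  IsArc⇒IsPolyArc arc i j i<j p onᵢ onⱼ =
    proj₁ r , trans (proj₂ r) (≡.sym (cong proj₂ (lookup-segs ps i)))
    where r = arc (toℕ i) (toℕ j) i<j (toℕ<n j) (subst (OnSeg p) (lookup-segs ps i) onᵢ)
                                                (subst (OnSeg p) (lookup-segs ps j) onⱼ)

  OnPoly⇒OnPath : ∀ {p} → OnPoly p ps → OnPath (path ps) (length (segs ps)) p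
  OnPoly⇒OnPath {p} (i , on) = toℕ i , toℕ<n i , subst (OnSeg p) (lookup-segs ps i) on

  OnPath⇒OnPoly : ∀ {p} → OnPath (path ps) (length (segs ps)) p → OnPoly p ps
  OnPath⇒OnPoly {p} (k , k<L , on) = fromℕ< k<L , subst (OnSeg p) (≡.sym (lookup-segs-fromℕ< k<L)) on

polyline : Point → List Point → Point → List Point
polyline a xs b = a ∷ xs ++ b ∷ []

length-segs-polyline : ∀ a xs b → length (segs (polyline a xs b)) ≡ suc (length xs)
length-segs-polyline a []       b = refl
length-segs-polyline a (x ∷ xs) b = cong suc (length-segs-polyline x xs b)

path-polyline-end : ∀ a xs b → path (polyline a xs b) (suc (length xs)) ≡ b
path-polyline-end a []       b = refl
path-polyline-end a (x ∷ xs) b = path-polyline-end x xs b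

path-polyline-applyUpTo : ∀ (f : Path) K {a b} → f 0 ≡ a → f (suc K) ≡ b →
                          ∀ k → k ≤ suc K → f k ≡ path (polyline a (applyUpTo (f ∘ suc) K) b) k
path-polyline-applyUpTo f K       f0≡a _ zero    _ = f0≡a
path-polyline-applyUpTo f zero    _ f1≡b (suc zero) _ = f1≡b
path-polyline-applyUpTo f zero    _ _    (suc (suc k)) (s≤s ())
path-polyline-applyUpTo f (suc K) _ f≡b (suc k) (s≤s k≤1+K) =
  path-polyline-applyUpTo (f ∘ suc) K refl f≡b k k≤1+K

record Arc (S : Point → Set) (a b : Point) : Set where
  field
    #bends : ℕ
    trace  : Path
    start  : trace 0 ≡ a
    end    : trace (suc #bends) ≡ b
    simple : IsArc trace (suc #bends)
    within : ∀ {q} → OnPath trace (suc #bends) q → S q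

  bends : List Point
  bends = applyUpTo (trace ∘ suc) #bends

  private
    trace≗polyline : ∀ k → k ≤ suc #bends → trace k ≡ path (polyline a bends b) k
    trace≗polyline = path-polyline-applyUpTo trace #bends start end

    #segs : length (segs (polyline a bends b)) ≡ suc #bends
    #segs = trans (length-segs-polyline a bends b) (cong suc (length-applyUpTo (trace ∘ suc) #bends))

  polyline-simple : IsPolyArc (polyline a bends b)
  polyline-simple = IsArc⇒IsPolyArc (polyline a bends b)
    (subst (IsArc (path (polyline a bends b))) (≡.sym #segs) (IsArc-cong trace≗polyline simple))

  polyline-within : ∀ {q} → OnPoly q (polyline a bends b) → S q
  polyline-within {q} on = within (OnPath-cong (λ k k≤ → ≡.sym (trace≗polyline k k≤))
    (subst (λ L → OnPath (path (polyline a bends b)) L q) #segs (OnPoly⇒OnPath (polyline a bends b) on)))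

polyArc : ∀ {a xs b} → IsPolyArc (polyline a xs b) → Arc (λ q → OnPoly q (polyline a xs b)) a b
polyArc {a} {xs} {b} arc = record
  { #bends = length xs
  ; trace  = path ps
  ; start  = refl
  ; end    = path-polyline-end a xs b
  ; simple = subst (IsArc (path ps)) #segs (IsPolyArc⇒IsArc ps arc)
  ; within = λ {q} on → OnPath⇒OnPoly ps (subst (λ L → OnPath (path ps) L q) (≡.sym #segs) on)
  }
  where
  ps = polyline a xs b
  #segs = length-segs-polyline a xs b

weaken : ∀ {S T a b} → (∀ {q} → S q → T q) → Arc S a b → Arc T a b
weaken S⊆T r = record { Arc r ; within = S⊆T ∘ Arc.within r }

reverse : ∀ {S a b} → Arc S a b → Arc S b a
reverse r = record
  { #bends = #bends
  ; trace  = reversePath trace (suc #bends)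
  ; start  = end
  ; end    = trans (cong trace (ℕ.n∸n≡0 #bends)) start
  ; simple = IsArc-reverse {trace} simple
  ; within = within ∘ OnPath-reverse {trace}
  }
  where open Arc r

final-entry : ∀ (f : Path) {b} L → f (suc L) ≡ b → f 0 ≢ b →
              ∃[ L′ ] L′ ≤ L × f (suc L′) ≡ b × f L′ ≢ b
final-entry f     zero    f1≡b f0≢b = zero , z≤n , f1≡b , f0≢b
final-entry f {b} (suc L) f≡b  f0≢b with f (suc L) ≟ₚ b
... | no f≢b = suc L , ℕ.≤-refl , f≡b , f≢b
... | yes f≡b′ with L′ , L′≤L , rest ← final-entry f L f≡b′ f0≢b = L′ , ℕ.m≤n⇒m≤1+n L′≤L , rest

ProperLast : ∀ {S a b} → Arc S a b → Set
ProperLast {b = b} r = Arc.trace r (Arc.#bends r) ≢ b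

ProperFirst : ∀ {S a b} → Arc S a b → Set
ProperFirst {a = a} r = Arc.trace r 1 ≢ a

trim : ∀ {S a b} → a ≢ b → Arc S a b → Σ[ r ∈ Arc S a b ] ProperLast r
trim {b = b} a≢b r = shorten (final-entry trace #bends end (λ e → a≢b (trans (≡.sym start) e)))
  where
  open Arc r
  shorten : (∃[ L′ ] L′ ≤ #bends × trace (suc L′) ≡ b × trace L′ ≢ b) →
            Σ[ r ∈ Arc _ _ b ] ProperLast r
  shorten (L′ , L′≤L , reach , before) =
    record { #bends = L′ ; trace = trace ; start = start ; end = reach
           ; simple = IsArc-prefix {trace} (s≤s L′≤L) simple
           ; within = within ∘ OnPath-prefix {trace} (s≤s L′≤L) } ,
    before

join : ∀ {S T a m b} (r : Arc S a m) (s : Arc T m b) → ProperLast r → ProperFirst s →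
       (∀ {q} → S q → T q → q ≡ m) → Arc (λ q → S q ⊎ T q) a b
join {S} {T} {m = m} r s r-proper s-proper S∩T⊆m = record
  { #bends = R.#bends + suc S.#bends
  ; trace  = concatPath R.trace (suc R.#bends) S.trace
  ; start  = trans (concatPath-≤ {R.trace} {S.trace} {suc R.#bends} z≤n) R.start
  ; end    = trans (concatPath-≥ joint (ℕ.m≤m+n (suc R.#bends) (suc S.#bends)))
                   (trans (cong S.trace (ℕ.m+n∸m≡n (suc R.#bends) (suc S.#bends))) S.end)
  ; simple = IsArc-concat R.simple S.simple joint
               (λ e → r-proper (trans e S.start)) (λ e → s-proper (trans e S.start))
               (λ onr ons → trans (S∩T⊆m (R.within onr) (S.within ons)) (≡.sym S.start))
  ; within = λ on → Data.Sum.map (λ o → R.within o) (λ o → S.within o)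
                                  (OnPath-concat {R.trace} {S.trace} joint on)
  }
  where
  module R = Arc r
  module S = Arc s
  joint : R.trace (suc R.#bends) ≡ S.trace 0
  joint = trans R.end (≡.sym S.start)

-- Counting

sum-allFin : ∀ {k} (f : Fin k → ℕ) → ListAction.sum (map f (allFin k)) ≡ sum f
sum-allFin {k} f = trans (cong ListAction.sum (map-tabulate id f)) (sum-tabulate f)
  where
  sum-tabulate : ∀ {k} (f : Fin k → ℕ) → ListAction.sum (tabulate f) ≡ sum f
  sum-tabulate {zero}  f = refl
  sum-tabulate {suc k} f = cong (f Fin.zero +_) (sum-tabulate (f ∘ Fin.suc))

sum-mono-≤ : ∀ {k} {f g : Fin k → ℕ} → (∀ i → f i ≤ g i) → sum f ≤ sum g
sum-mono-≤ {zero}  f≤g = z≤n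
sum-mono-≤ {suc k} f≤g = ℕ.+-mono-≤ (f≤g Fin.zero) (sum-mono-≤ (f≤g ∘ Fin.suc))

term≤sum : ∀ {k} (f : Fin k → ℕ) i → f i ≤ sum f
term≤sum {suc k} f i = subst (f i ≤_) (≡.sym (sum-remove {i = i} f)) (ℕ.m≤m+n (f i) _)

pair≤sum : ∀ {k} (f : Fin k → ℕ) {i j} → i ≢ j → f i + f j ≤ sum f
pair≤sum {suc k} f {i} {j} i≢j = begin
  f i + f j                        ≡⟨ cong (λ x → f i + f x) (punchIn-punchOut i≢j) ⟨
  f i + f (punchIn i (punchOut i≢j)) ≤⟨ ℕ.+-monoʳ-≤ (f i) (term≤sum (f ∘ punchIn i) (punchOut i≢j)) ⟩
  f i + sum (f ∘ punchIn i)        ≡⟨ sum-remove {i = i} f ⟨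
  sum f                            ∎
  where open ℕ.≤-Reasoning

-- does (m ℕ.<? n) reduces to m ℕ.<ᵇ n
<ᵇ-true : ∀ {m n} → m < n → (m ℕ.<ᵇ n) ≡ true
<ᵇ-true {m} {n} = dec-true (m ℕ.<? n)

<ᵇ-false : ∀ {m n} → ¬ m < n → (m ℕ.<ᵇ n) ≡ false
<ᵇ-false {m} {n} = dec-false (m ℕ.<? n)

b2n-∨ : ∀ a b → b2n (a ∨ b) ≤ b2n a + b2n b
b2n-∨ true  b = s≤s z≤n
b2n-∨ false b = ℕ.≤-refl

sum-except : ∀ {k} (g : Fin k → Bool) i →
             b2n (g i) + sum (λ j → b2n (g j ∧ not (does (i ≟ j)))) ≡ sum (λ j → b2n (g j))
sum-except {suc k} g i = begin
  b2n (g i) + sum (λ j → b2n (g j ∧ not (does (i ≟ j))))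
    ≡⟨ cong (b2n (g i) +_) (sum-remove {i = i} (λ j → b2n (g j ∧ not (does (i ≟ j))))) ⟩
  b2n (g i) + (b2n (g i ∧ not (does (i ≟ i))) + sum (λ j → b2n (g (punchIn i j) ∧ not (does (i ≟ punchIn i j)))))
    ≡⟨ cong (b2n (g i) +_) (cong₂ _+_ at-i (sum-cong-≗ {k} off-i)) ⟩
  b2n (g i) + sum (λ j → b2n (g (punchIn i j)))
    ≡⟨ sum-remove {i = i} (λ j → b2n (g j)) ⟨
  sum (λ j → b2n (g j)) ∎
  where
  open ≡-Reasoning
  at-i : b2n (g i ∧ not (does (i ≟ i))) ≡ 0
  at-i = trans (cong (λ d → b2n (g i ∧ not d)) (dec-true (i ≟ i) refl)) (cong b2n (∧-zeroʳ (g i)))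
  off-i : ∀ j → b2n (g (punchIn i j) ∧ not (does (i ≟ punchIn i j))) ≡ b2n (g (punchIn i j))
  off-i j = trans (cong (λ d → b2n (g (punchIn i j) ∧ not d))
                        (dec-false (i ≟ punchIn i j) (punchInᵢ≢i i j ∘ ≡.sym)))
                  (cong b2n (∧-identityʳ (g (punchIn i j))))

module _ (G : Graph) where

  degree≡sum : ∀ x → degree G x ≡ sum (λ y → b2n (adj G x y))
  degree≡sum x = sum-allFin (λ y → b2n (adj G x y))

  private
    e : Fin (n G) → Fin (n G) → ℕ
    e x y = b2n (adj G x y ∧ (toℕ x ℕ.<ᵇ toℕ y))

    numEdges≡sum : numEdges G ≡ sum (λ x → sum (e x))
    numEdges≡sum = trans (sum-allFin (λ x → ListAction.sum (map (e x) (allFin (n G)))))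
                         (sum-cong-≗ {n G} λ x → sum-allFin (e x))

    edge-split : ∀ x y → b2n (adj G x y) ≡ e x y + e y x
    edge-split x y rewrite sym G y x with ℕ.<-cmp (toℕ x) (toℕ y)
    ... | tri< x<y _ y≮x rewrite <ᵇ-true x<y | <ᵇ-false y≮x = split (adj G x y)
      where
      split : ∀ a → b2n a ≡ b2n (a ∧ true) + b2n (a ∧ false)
      split true  = refl
      split false = refl
    ... | tri> x≮y _ y<x rewrite <ᵇ-false x≮y | <ᵇ-true y<x = split (adj G x y)
      where
      split : ∀ a → b2n a ≡ b2n (a ∧ false) + b2n (a ∧ true)
      split true  = refl
      split false = refl
    ... | tri≈ _ x≡y _ with refl ← toℕ-injective x≡y rewrite irrefl G x = refl

  handshake : sum (degree G) ≡ 2 * numEdges G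
  handshake = begin
    sum (degree G)
      ≡⟨ sum-cong-≗ {n G} degree≡sum ⟩
    sum (λ x → sum (λ y → b2n (adj G x y)))
      ≡⟨ sum-cong-≗ {n G} (λ x → sum-cong-≗ {n G} (edge-split x)) ⟩
    sum (λ x → sum (λ y → e x y + e y x))
      ≡⟨ sum-cong-≗ {n G} (λ x → ∑-distrib-+ (e x) (λ y → e y x)) ⟩
    sum (λ x → sum (e x) + sum (λ y → e y x))
      ≡⟨ ∑-distrib-+ (λ x → sum (e x)) (λ x → sum (λ y → e y x)) ⟩
    E + sum (λ x → sum (λ y → e y x))
      ≡⟨ cong (E +_) (∑-comm (λ x y → e y x)) ⟩
    E + E
      ≡⟨ cong (E +_) (ℕ.+-identityʳ E) ⟨
    2 * E
      ≡⟨ cong (2 *_) numEdges≡sum ⟨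
    2 * numEdges G ∎
    where
    open ≡-Reasoning
    E = sum (λ x → sum (e x))

-- Colouring one more vertex

length-filterᵇ : ∀ {A : Set} (p : A → Bool) xs →
                 length (filterᵇ p xs) ≡ ListAction.sum (map (b2n ∘ p) xs)
length-filterᵇ p []       = refl
length-filterᵇ p (x ∷ xs) with p x
... | true  = cong suc (length-filterᵇ p xs)
... | false = length-filterᵇ p xs

length-concatMap-≤ : ∀ {A B : Set} (f : A → List B) {c} → (∀ x → length (f x) ≤ c) →
                     ∀ xs → length (concatMap f xs) ≤ length xs * c
length-concatMap-≤ f f≤c []       = z≤n
length-concatMap-≤ f f≤c (x ∷ xs) = begin
  length (f x ++ concatMap f xs)        ≡⟨ length-++ (f x) ⟩
  length (f x) + length (concatMap f xs) ≤⟨ ℕ.+-mono-≤ (f≤c x) (length-concatMap-≤ f f≤c xs) ⟩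
  _ + length xs * _                      ∎
  where open ℕ.≤-Reasoning

∃∉ : ∀ {k} (cs : List (Fin k)) → length cs < k → ∃[ c ] c ∉ cs
∃∉ {k} cs |cs|<k = ¬∀⟶∃¬ k (_∈ cs) (λ c → any? (c ≟_) cs) all∈
  where
  all∈ : ¬ (∀ c → c ∈ cs)
  all∈ c∈ with i , j , i<j , same ← pigeonhole |cs|<k (index ∘ c∈) =
    ℕ.<-irrefl (cong toℕ i≡j) i<j
    where
    i≡j = trans (lookup-index (c∈ i)) (trans (cong (lookup cs) same) (≡.sym (lookup-index (c∈ j))))

module _ (G : Graph) where

  neighbours : Fin (n G) → List (Fin (n G))
  neighbours x = filterᵇ (adj G x) (allFin (n G))

  length-neighbours : ∀ x → length (neighbours x) ≡ degree G x
  length-neighbours x = length-filterᵇ (adj G x) (allFin (n G))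

  ∈-neighbours : ∀ {x y} → Adj G x y → y ∈ neighbours x
  ∈-neighbours {x} {y} x~y = ∈-filter⁺ (T? ∘ adj G x) (∈-allFin y) (subst T (≡.sym x~y) tt)

  -- with repetitions, and containing x itself unless x is isolated
  ball₂ : Fin (n G) → List (Fin (n G))
  ball₂ x = concatMap (λ z → z ∷ neighbours z) (neighbours x)

  Within2⇒∈ball₂ : ∀ {x y} → Within2 G x y → y ∈ ball₂ x
  Within2⇒∈ball₂ (_ , inj₁ x~y)            = ∈-concat⁺′ (here refl) (∈-map⁺ _ (∈-neighbours x~y))
  Within2⇒∈ball₂ (_ , inj₂ (z , x~z , z~y)) =
    ∈-concat⁺′ (there (∈-neighbours z~y)) (∈-map⁺ _ (∈-neighbours x~z))

  length-ball₂ : ∀ {Δ} → MaxDegreeAtMost Δ G → ∀ x → length (ball₂ x) ≤ degree G x * suc Δ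
  length-ball₂ maxDeg x =
    subst (λ d → length (ball₂ x) ≤ d * _) (length-neighbours x)
      (length-concatMap-≤ (λ z → z ∷ neighbours z)
         (λ z → s≤s (subst (_≤ _) (≡.sym (length-neighbours z)) (maxDeg z))) (neighbours x))

  free-colour : ∀ {Δ k} → MaxDegreeAtMost Δ G → ∀ x → degree G x * suc Δ < k → (ψ : Fin (n G) → Fin k) →
                ∃[ c ] ∀ y → Within2 G x y → ψ y ≢ c
  free-colour {Δ} {k} maxDeg x small ψ = map₂ avoid (∃∉ (map ψ (ball₂ x)) few)
    where
    few : length (map ψ (ball₂ x)) < k
    few = begin-strict
      length (map ψ (ball₂ x)) ≡⟨ length-map ψ (ball₂ x) ⟩
      length (ball₂ x)         ≤⟨ length-ball₂ maxDeg x ⟩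
      degree G x * suc Δ       <⟨ small ⟩
      k                        ∎
      where open ℕ.≤-Reasoning
    avoid : ∀ {c} → c ∉ map ψ (ball₂ x) → ∀ y → Within2 G x y → ψ y ≢ c
    avoid c∉ y w ψy≡c = c∉ (subst (_∈ _) ψy≡c (∈-map⁺ ψ (Within2⇒∈ball₂ w)))

  Within2-sym : ∀ {x y} → Within2 G x y → Within2 G y x
  Within2-sym {x} {y} (x≢y , inj₁ x~y)            = x≢y ∘ ≡.sym , inj₁ (trans (sym G y x) x~y)
  Within2-sym {x} {y} (x≢y , inj₂ (z , x~z , z~y)) =
    x≢y ∘ ≡.sym , inj₂ (z , trans (sym G y z) z~y , trans (sym G z x) x~z)

  recolour : ∀ {k} → (Fin (n G) → Fin k) → Fin (n G) → Fin k → Fin (n G) → Fin k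
  recolour ψ v c x with x ≟ v
  ... | yes _ = c
  ... | no _  = ψ x

  recolour-colouring : ∀ {k} (ψ : Fin (n G) → Fin k) v c →
    (∀ x y → x ≢ v → y ≢ v → Within2 G x y → ψ x ≢ ψ y) → (∀ y → Within2 G v y → ψ y ≢ c) →
    TwoDistColoring G k (recolour ψ v c)
  recolour-colouring ψ v c ψ-ok c-free x y w with x ≟ v | y ≟ v
  ... | yes refl | yes refl = ⊥-elim (proj₁ w refl)
  ... | yes refl | no _     = c-free y w ∘ ≡.sym
  ... | no _     | yes refl = c-free x (Within2-sym w)
  ... | no x≢v   | no y≢v   = ψ-ok x y x≢v y≢v w

-- Plane drawings

module _ {G : Graph} (D : PlaneDrawing G) where
  open PlaneDrawing D

  Endpoint : Edge G → Fin (n G) → Set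
  Endpoint e z = z ≡ proj₁ (proj₁ e) ⊎ z ≡ proj₂ (proj₁ e)

  OnEdge : Edge G → Point → Set
  OnEdge e q = OnPoly q (arc e)

  record Link (x y : Fin (n G)) : Set where
    field
      edge     : Edge G
      distinct : x ≢ y
      source   : Endpoint edge x
      target   : Endpoint edge y
      ends     : ∀ {z} → Endpoint edge z → z ≡ x ⊎ z ≡ y
      route    : Arc (OnEdge edge) (pos x) (pos y)

  link : ∀ {x y} → Adj G x y → Link x y
  link {x} {y} x~y with ℕ.<-cmp (toℕ x) (toℕ y)
  ... | tri< x<y _ _ = record
    { edge = e ; distinct = λ x≡y → ℕ.<-irrefl (cong toℕ x≡y) x<y
    ; source = inj₁ refl ; target = inj₂ refl ; ends = id
    ; route = polyArc {pos x} {bends e} (arc-simple e) }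
    where e = (x , y) , x~y , x<y
  ... | tri> _ _ y<x = record
    { edge = e ; distinct = λ x≡y → ℕ.<-irrefl (cong toℕ (≡.sym x≡y)) y<x
    ; source = inj₂ refl ; target = inj₁ refl ; ends = Data.Sum.swap
    ; route = reverse (polyArc {pos y} {bends e} (arc-simple e)) }
    where e = (y , x) , trans (sym G y x) x~y , y<x
  ... | tri≈ _ x≡y _ with refl ← toℕ-injective x≡y with () ← trans (≡.sym (irrefl G x)) x~y

  pos-≢ : ∀ {x y} → x ≢ y → pos x ≢ pos y
  pos-≢ x≢y = x≢y ∘ pos-inj _ _

  -- The arcs of the edges xy and yz meet only in pos y, so following one and then
  -- the other is an arc, once degenerate segments at pos y are cut off.
  through : ∀ {x y z} (X : Link x y) (Y : Link y z) → x ≢ z →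
            Arc (λ q → OnEdge (Link.edge X) q ⊎ OnEdge (Link.edge Y) q) (pos x) (pos z)
  through {x} {y} {z} X Y x≢z = join (proj₁ toY) (reverse (proj₁ toY′)) (proj₂ toY) (proj₂ toY′) meet
    where
    module X = Link X
    module Y = Link Y
    toY  = trim (pos-≢ X.distinct) X.route
    toY′ = trim (pos-≢ (Y.distinct ∘ ≡.sym)) (reverse Y.route)

    distinct-edges : proj₁ X.edge ≢ proj₁ Y.edge
    distinct-edges same with Y.ends (subst (λ p → x ≡ proj₁ p ⊎ x ≡ proj₂ p) same X.source)
    ... | inj₁ x≡y = X.distinct x≡y
    ... | inj₂ x≡z = x≢z x≡z

    meet : ∀ {q} → OnEdge X.edge q → OnEdge Y.edge q → q ≡ pos y
    meet {q} onX onY with w , refl ← arcs-disj X.edge Y.edge distinct-edges q onX onY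
      with X.ends (arc-avoids X.edge w onX) | Y.ends (arc-avoids Y.edge w onY)
    ... | inj₂ w≡y | _          = cong pos w≡y
    ... | _        | inj₁ w≡y   = cong pos w≡y
    ... | inj₁ w≡x | inj₂ w≡z   = ⊥-elim (x≢z (trans (≡.sym w≡x) w≡z))

-- Eliminating a vertex

does-≟-sym : ∀ {k} (i j : Fin k) → does (i ≟ j) ≡ does (j ≟ i)
does-≟-sym i j with i ≟ j | j ≟ i
... | yes _   | yes _   = refl
... | no _    | no _    = refl
... | yes i≡j | no j≢i  = ⊥-elim (j≢i (≡.sym i≡j))
... | no i≢j  | yes j≡i = ⊥-elim (i≢j (≡.sym j≡i))

-- H is G − v with the neighbours of v made pairwise adjacent; vertex i of H is
-- vertex ι i of G. The module takes the fields of G so that n G is suc m.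
module Elimination {m : ℕ} (A : Fin (suc m) → Fin (suc m) → Bool)
                   (A-sym : ∀ x y → A x y ≡ A y x) (A-irrefl : ∀ x → A x x ≡ false)
                   (v : Fin (suc m)) where

  G : Graph
  G = record { n = suc m ; adj = A ; sym = A-sym ; irrefl = A-irrefl }

  ι : Fin m → Fin (suc m)
  ι = punchIn v

  ι-injective : ∀ {i j} → ι i ≡ ι j → i ≡ j
  ι-injective = punchIn-injective v _ _

  ι≢v : ∀ i → ι i ≢ v
  ι≢v = punchInᵢ≢i v

  ι-mono-< : ∀ {i j} → toℕ i < toℕ j → toℕ (ι i) < toℕ (ι j)
  ι-mono-< {i} {j} i<j =
    ℕ.≤∧≢⇒< (punchIn-mono-≤ v i j (ℕ.<⇒≤ i<j)) (ℕ.<⇒≢ i<j ∘ cong toℕ ∘ ι-injective ∘ toℕ-injective)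

  ι-onto : ∀ {x} → x ≢ v → ∃[ i ] ι i ≡ x
  ι-onto x≢v = punchOut (x≢v ∘ ≡.sym) , punchIn-punchOut (x≢v ∘ ≡.sym)

  fill : Fin m → Fin m → Bool
  fill i j = (A (ι i) v ∧ A (ι j) v) ∧ not (does (i ≟ j))

  H : Graph
  H = record
    { n      = m
    ; adj    = λ i j → A (ι i) (ι j) ∨ fill i j
    ; sym    = λ i j → cong₂ _∨_ (A-sym (ι i) (ι j))
                         (cong₂ (λ a b → a ∧ not b) (∧-comm (A (ι i) v) (A (ι j) v)) (does-≟-sym i j))
    ; irrefl = λ i → trans (cong₂ (λ a b → a ∨ (A (ι i) v ∧ A (ι i) v) ∧ not b)
                                  (A-irrefl (ι i)) (dec-true (i ≟ i) refl))
                           (∧-zeroʳ (A (ι i) v ∧ A (ι i) v))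
    }

  Adj-H-old : ∀ {i j} → Adj G (ι i) (ι j) → Adj H i j
  Adj-H-old {i} {j} i~j = cong (_∨ fill i j) i~j

  Fill : Fin m → Fin m → Set
  Fill i j = Adj G (ι i) v × Adj G (ι j) v × i ≢ j

  fill⁺ : ∀ {i j} → Fill i j → fill i j ≡ true
  fill⁺ {i} {j} (i~v , j~v , i≢j) = cong₂ (λ a b → a ∧ not b) (cong₂ _∧_ i~v j~v) (dec-false (i ≟ j) i≢j)

  fill⁻ : ∀ {i j} → fill i j ≡ true → Fill i j
  fill⁻ {i} {j} fill≡true with A (ι i) v | A (ι j) v | i ≟ j | fill≡true
  ... | true | true | no i≢j | _ = refl , refl , i≢j

  Adj-H-fill : ∀ {i j} → Fill i j → Adj H i j
  Adj-H-fill {i} {j} f = trans (cong (A (ι i) (ι j) ∨_) (fill⁺ f)) (∨-zeroʳ (A (ι i) (ι j)))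

  classify : ∀ {i j} → Adj H i j → Adj G (ι i) (ι j) ⊎ Fill i j
  classify {i} {j} i~j with A (ι i) (ι j)
  ... | true  = inj₁ refl
  ... | false = inj₂ (fill⁻ i~j)

  Within2-H : ∀ {i j} → Within2 G (ι i) (ι j) → Within2 H i j
  Within2-H (ιi≢ιj , inj₁ i~j) = ιi≢ιj ∘ cong ι , inj₁ (Adj-H-old i~j)
  Within2-H {i} {j} (ιi≢ιj , inj₂ (z , i~z , z~j)) with z ≟ v
  ... | yes refl = ιi≢ιj ∘ cong ι , inj₁ (Adj-H-fill (i~z , trans (A-sym (ι j) v) z~j , ιi≢ιj ∘ cong ι))
  ... | no z≢v with k , refl ← ι-onto z≢v = ιi≢ιj ∘ cong ι , inj₂ (k , Adj-H-old i~z , Adj-H-old z~j)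

  -- c₀ is a placeholder colour for v
  lift : ∀ {k} → Fin k → (Fin m → Fin k) → Fin (suc m) → Fin k
  lift c₀ ψ x with v ≟ x
  ... | yes _   = c₀
  ... | no v≢x  = ψ (punchOut v≢x)

  lift-ι : ∀ {k} (c₀ : Fin k) ψ i → lift c₀ ψ (ι i) ≡ ψ i
  lift-ι c₀ ψ i with v ≟ ι i
  ... | yes v≡ιi = ⊥-elim (ι≢v i (≡.sym v≡ιi))
  ... | no v≢ιi  = cong ψ (trans (punchOut-cong v refl) (punchOut-punchIn v))

  lift-colouring : ∀ {k} (c₀ : Fin k) {ψ} → TwoDistColoring H k ψ →
                   ∀ x y → x ≢ v → y ≢ v → Within2 G x y → lift c₀ ψ x ≢ lift c₀ ψ y
  lift-colouring c₀ {ψ} ψ-ok x y x≢v y≢v w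
    with i , refl ← ι-onto x≢v | j , refl ← ι-onto y≢v
    rewrite lift-ι c₀ ψ i | lift-ι c₀ ψ j = ψ-ok i j (Within2-H w)

  degree-v : degree G v ≡ sum (λ i → b2n (A (ι i) v))
  degree-v = begin
    degree G v                                 ≡⟨ degree≡sum G v ⟩
    sum (λ x → b2n (A v x))                    ≡⟨ sum-remove {i = v} (λ x → b2n (A v x)) ⟩
    b2n (A v v) + sum (λ i → b2n (A v (ι i)))  ≡⟨ cong₂ _+_ (cong b2n (A-irrefl v))
                                                           (sum-cong-≗ {m} λ i → cong b2n (A-sym v (ι i))) ⟩
    sum (λ i → b2n (A (ι i) v))                ∎
    where open ≡-Reasoning

  module LowDegree (deg≤2 : degree G v ≤ 2) where

    fill-row : ∀ i → sum (λ j → b2n (fill i j)) ≤ b2n (A (ι i) v)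
    fill-row i = row (A (ι i) v) refl
      where
      row : ∀ a → A (ι i) v ≡ a → sum (λ j → b2n ((a ∧ A (ι j) v) ∧ not (does (i ≟ j)))) ≤ b2n a
      row false _   = ℕ.≤-reflexive (sum-replicate-zero m)
      row true  i~v = ℕ.≤-pred (begin
        suc (sum (λ j → b2n (A (ι j) v ∧ not (does (i ≟ j)))))
          ≡⟨ cong (λ a → b2n a + sum (λ j → b2n (A (ι j) v ∧ not (does (i ≟ j))))) i~v ⟨
        b2n (A (ι i) v) + sum (λ j → b2n (A (ι j) v ∧ not (does (i ≟ j))))
          ≡⟨ sum-except (λ j → A (ι j) v) i ⟩
        sum (λ j → b2n (A (ι j) v))
          ≡⟨ degree-v ⟨
        degree G v
          ≤⟨ deg≤2 ⟩
        2 ∎)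
        where open ℕ.≤-Reasoning

    degree-H : ∀ i → degree H i ≤ degree G (ι i)
    degree-H i = begin
      degree H i
        ≡⟨ degree≡sum H i ⟩
      sum (λ j → b2n (A (ι i) (ι j) ∨ fill i j))
        ≤⟨ sum-mono-≤ (λ j → b2n-∨ (A (ι i) (ι j)) (fill i j)) ⟩
      sum (λ j → b2n (A (ι i) (ι j)) + b2n (fill i j))
        ≡⟨ ∑-distrib-+ (λ j → b2n (A (ι i) (ι j))) (λ j → b2n (fill i j)) ⟩
      sum (λ j → b2n (A (ι i) (ι j))) + sum (λ j → b2n (fill i j))
        ≤⟨ ℕ.+-monoʳ-≤ _ (fill-row i) ⟩
      sum (λ j → b2n (A (ι i) (ι j))) + b2n (A (ι i) v)
        ≡⟨ ℕ.+-comm _ (b2n (A (ι i) v)) ⟩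
      b2n (A (ι i) v) + sum (λ j → b2n (A (ι i) (ι j)))
        ≡⟨ sum-remove {i = v} (λ y → b2n (A (ι i) y)) ⟨
      sum (λ y → b2n (A (ι i) y))
        ≡⟨ degree≡sum G (ι i) ⟨
      degree G (ι i) ∎
      where open ℕ.≤-Reasoning

    maxDegree-H : ∀ {Δ} → MaxDegreeAtMost Δ G → MaxDegreeAtMost Δ H
    maxDegree-H maxDeg i = ℕ.≤-trans (degree-H i) (maxDeg (ι i))

    numEdges-H : numEdges H ≤ numEdges G
    numEdges-H = ℕ.*-cancelˡ-≤ 2 (begin
      2 * numEdges H                     ≡⟨ handshake H ⟨
      sum (degree H)                     ≤⟨ sum-mono-≤ degree-H ⟩
      sum (degree G ∘ ι)                 ≤⟨ ℕ.m≤n+m _ (degree G v) ⟩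
      degree G v + sum (degree G ∘ ι)    ≡⟨ sum-remove {i = v} (degree G) ⟨
      sum (degree G)                     ≡⟨ handshake G ⟩
      2 * numEdges G                     ∎)
      where open ℕ.≤-Reasoning

    size-H : size H < size G
    size-H = s≤s (ℕ.+-monoʳ-≤ m numEdges-H)

    third-neighbour : ∀ {a b c} → Fill a b → Adj G (ι c) v → c ≡ a ⊎ c ≡ b
    third-neighbour {a} {b} {c} (a~v , b~v , a≢b) c~v with c ≟ a | c ≟ b
    ... | yes c≡a | _       = inj₁ c≡a
    ... | no _    | yes c≡b = inj₂ c≡b
    ... | no c≢a  | no c≢b  = ⊥-elim (ℕ.<-irrefl refl (begin
      2                                ≡⟨ cong₂ _+_ (cong b2n (fill⁺ (a~v , b~v , a≢b)))
                                                   (cong b2n (fill⁺ (a~v , c~v , c≢a ∘ ≡.sym))) ⟨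
      b2n (fill a b) + b2n (fill a c)  ≤⟨ pair≤sum (λ j → b2n (fill a j)) (c≢b ∘ ≡.sym) ⟩
      sum (λ j → b2n (fill a j))       ≤⟨ fill-row a ⟩
      b2n (A (ι a) v)                  ≡⟨ cong b2n a~v ⟩
      1                                ∎))
      where open ℕ.≤-Reasoning

    extend-colouring : ∀ {Δ k} → MaxDegreeAtMost Δ G → 2 * suc Δ < k →
                       TwoDistColorable k H → TwoDistColorable k G
    extend-colouring {Δ} {k} maxDeg small (ψH , ψH-ok) = extend (free-colour G maxDeg v few ψ)
      where
      c₀ = fromℕ< (ℕ.≤-<-trans z≤n small)
      ψ = lift c₀ ψH
      few = ℕ.≤-<-trans (ℕ.*-monoˡ-≤ (suc Δ) deg≤2) small
      extend : (∃[ c ] ∀ y → Within2 G v y → ψ y ≢ c) → TwoDistColorable k G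
      extend (c , c-free) = recolour G ψ v c , recolour-colouring G ψ v c (lift-colouring c₀ ψH-ok) c-free

    Fill-unique : ∀ {i j i′ j′} → toℕ i < toℕ j → toℕ i′ < toℕ j′ →
                  Fill i j → Fill i′ j′ → (i , j) ≡ (i′ , j′)
    Fill-unique i<j i′<j′ f (i′~v , j′~v , _) with third-neighbour f i′~v | third-neighbour f j′~v
    ... | inj₁ refl | inj₂ refl = refl
    ... | inj₁ refl | inj₁ refl = ⊥-elim (ℕ.<-irrefl refl i′<j′)
    ... | inj₂ refl | inj₂ refl = ⊥-elim (ℕ.<-irrefl refl i′<j′)
    ... | inj₂ refl | inj₁ refl = ⊥-elim (ℕ.<-asym i<j i′<j′)

    module _ (D : PlaneDrawing G) where
      open PlaneDrawing D

      record Carrier (i j : Fin m) (q : Point) : Set where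
        field
          edge : Edge G
          on   : OnEdge D edge q
          ends : ∀ {z} → Endpoint D edge z → z ≡ ι i ⊎ z ≡ ι j ⊎ z ≡ v
          kind : proj₁ edge ≡ (ι i , ι j) ⊎ (Endpoint D edge v × Fill i j)

      detour : ∀ {i j} → Fill i j → Arc (Carrier i j) (pos (ι i)) (pos (ι j))
      detour {i} {j} f@(i~v , j~v , i≢j) = weaken carry (through D X Y (i≢j ∘ ι-injective))
        where
        X = link D i~v
        Y = link D (trans (A-sym v (ι j)) j~v)
        carry : ∀ {q} → OnEdge D (Link.edge X) q ⊎ OnEdge D (Link.edge Y) q → Carrier i j q
        carry (inj₁ onX) = record
          { edge = Link.edge X ; on = onX
          ; ends = Data.Sum.map₂ inj₂ ∘ Link.ends X
          ; kind = inj₂ (Link.target X , f) }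
        carry (inj₂ onY) = record
          { edge = Link.edge Y ; on = onY
          ; ends = Data.Sum.[ inj₂ ∘ inj₂ , inj₂ ∘ inj₁ ] ∘ Link.ends Y
          ; kind = inj₂ (Link.source Y , f) }

      oldEdge : ∀ {i j} → Adj G (ι i) (ι j) → toℕ i < toℕ j → Edge G
      oldEdge i~j i<j = (_ , _) , i~j , ι-mono-< i<j

      bendsH : Edge H → List Point
      bendsH ((i , j) , i~j , i<j) with classify i~j
      ... | inj₁ old  = bends (oldEdge old i<j)
      ... | inj₂ fill = Arc.bends (detour fill)

      arcH : Edge H → List Point
      arcH e@((i , j) , _) = polyline (pos (ι i)) (bendsH e) (pos (ι j))

      arcH-simple : ∀ e → IsPolyArc (arcH e)
      arcH-simple ((i , j) , i~j , i<j) with classify i~j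
      ... | inj₁ old  = arc-simple (oldEdge old i<j)
      ... | inj₂ fill = Arc.polyline-simple (detour fill)

      carrier : ∀ e {q} → OnPoly q (arcH e) → Carrier (proj₁ (proj₁ e)) (proj₂ (proj₁ e)) q
      carrier ((i , j) , i~j , i<j) on with classify i~j
      ... | inj₁ old  = record { edge = oldEdge old i<j ; on = on ; ends = Data.Sum.map₂ inj₁ ; kind = inj₁ refl }
      ... | inj₂ fill = Arc.polyline-within (detour fill) on

      arcH-avoids : ∀ e w → OnPoly (pos (ι w)) (arcH e) → w ≡ proj₁ (proj₁ e) ⊎ w ≡ proj₂ (proj₁ e)
      arcH-avoids e w on = classify-end (Carrier.ends C (arc-avoids (Carrier.edge C) (ι w) (Carrier.on C)))
        where
        C = carrier e on
        classify-end : ι w ≡ ι (proj₁ (proj₁ e)) ⊎ ι w ≡ ι (proj₂ (proj₁ e)) ⊎ ι w ≡ v → _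
        classify-end (inj₁ ιw≡ιi)        = inj₁ (ι-injective ιw≡ιi)
        classify-end (inj₂ (inj₁ ιw≡ιj)) = inj₂ (ι-injective ιw≡ιj)
        classify-end (inj₂ (inj₂ ιw≡v))  = ⊥-elim (ι≢v w ιw≡v)

      old-carrier-distinct : ∀ {i j i′ j′ q} → (i , j) ≢ (i′ , j′) → (C : Carrier i j q) →
                             proj₁ (Carrier.edge C) ≡ (ι i , ι j) → (C′ : Carrier i′ j′ q) →
                             proj₁ (Carrier.edge C) ≢ proj₁ (Carrier.edge C′)
      old-carrier-distinct ne C C-old C′ same with Carrier.kind C′
      ... | inj₁ C′-old with ιi≡ιi′ , ιj≡ιj′ ← ,-injective (trans (≡.sym C-old) (trans same C′-old)) =
        ne (cong₂ _,_ (ι-injective ιi≡ιi′) (ι-injective ιj≡ιj′))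
      ... | inj₂ (v-end , _) with subst (λ p → v ≡ proj₁ p ⊎ v ≡ proj₂ p) (trans (≡.sym same) C-old) v-end
      ...   | inj₁ v≡ιi = ι≢v _ (≡.sym v≡ιi)
      ...   | inj₂ v≡ιj = ι≢v _ (≡.sym v≡ιj)

      old-carrier-meets : ∀ {i j i′ j′ q} → (i , j) ≢ (i′ , j′) → (C : Carrier i j q) →
                          proj₁ (Carrier.edge C) ≡ (ι i , ι j) → Carrier i′ j′ q → ∃[ w ] q ≡ pos (ι w)
      old-carrier-meets {i} {j} {q = q} ne C C-old C′
        with z , refl ← arcs-disj (Carrier.edge C) (Carrier.edge C′) (old-carrier-distinct ne C C-old C′) q
                                  (Carrier.on C) (Carrier.on C′)
        with subst (λ p → z ≡ proj₁ p ⊎ z ≡ proj₂ p) C-old (arc-avoids (Carrier.edge C) z (Carrier.on C))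
      ... | inj₁ refl = i , refl
      ... | inj₂ refl = j , refl

      carriers-meet : ∀ {i j i′ j′ q} → (i , j) ≢ (i′ , j′) → toℕ i < toℕ j → toℕ i′ < toℕ j′ →
                      Carrier i j q → Carrier i′ j′ q → ∃[ w ] q ≡ pos (ι w)
      carriers-meet ne i<j i′<j′ C C′ with Carrier.kind C | Carrier.kind C′
      ... | inj₁ C-old     | _               = old-carrier-meets ne C C-old C′
      ... | inj₂ _         | inj₁ C′-old     = old-carrier-meets (ne ∘ ≡.sym) C′ C′-old C
      ... | inj₂ (_ , f)   | inj₂ (_ , f′)   = ⊥-elim (ne (Fill-unique i<j i′<j′ f f′))

      drawing-H : PlaneDrawing H
      drawing-H = record
        { pos        = pos ∘ ι
        ; pos-inj    = λ i j → ι-injective ∘ pos-inj (ι i) (ι j)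
        ; bends      = bendsH
        ; arc-simple = arcH-simple
        ; arc-avoids = arcH-avoids
        ; arcs-disj  = λ e f e≢f q on on′ →
            carriers-meet e≢f (proj₂ (proj₂ e)) (proj₂ (proj₂ f)) (carrier e on) (carrier f on′)
        }

lemma1 : (G : Graph) → MinimalCounterexample G → MinDegreeAtLeast 3 G
lemma1 record { n = zero } _ ()
lemma1 G@record { n = suc m ; adj = A ; sym = A-sym ; irrefl = A-irrefl } mc v with 3 ℕ.≤? degree G v
... | yes 3≤deg = 3≤deg
... | no 3≰deg  = ⊥-elim (notColor (extend-colouring maxDeg (from-yes (14 ℕ.<? 20)) colouring-H))
  where
  open MinimalCounterexample mc
  open Elimination A A-sym A-irrefl v hiding (G)
  open LowDegree (ℕ.≤-pred (ℕ.≰⇒> 3≰deg))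
  colouring-H = minimal H (drawing-H planar) (maxDegree-H maxDeg) size-H
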